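{- For any integers $m,n$ with $1<m\le n/2$, the permutation $B'(m,n)$ of $\{1,\dots,n\}$ is cyclic (a single $n$-cycle), and $\Gamma(P(B'(m,n)))$ consists of $m$ entries equal to $2$ followed by $n-2m$ entries equal to $1$.
   Context: Permutations are written as sequences $(\sigma_1,\dots,\sigma_n)$ with $\sigma_i$ the image of $i$. For an integer $N\ge1$, $L(N)$ is the decreasing sequence of the elements of $\{1,\dots,N\}\setminus\{\lceil N/2\rceil\}$. $I(\sigma)$ adds $1$ to every entry, $I^k$ is its $k$-fold iterate, and $\oplus$ is concatenation. For $1<m\le n/2$, $B'(m,n)=(\lceil (n+m)/2\rceil)\oplus I(L(m-1))\oplus(1)\oplus I^{m}(L(n-m))\oplus(\lfloor m/2\rfloor+1)$. $P(\sigma)$ is the Robinson--Schensted--Knuth insertion tableau of $\sigma$ (Schensted row insertion of the entries in order), and $\Gamma(P(\sigma))$ its shape (row lengths, nonincreasing). -}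

module Defs where

open import Data.Nat using (ℕ; zero; suc; _+_; _*_; _∸_; _<?_; _≟_; ⌊_/2⌋; ⌈_/2⌉)
open import Data.List using (List; []; _∷_; _++_; map; filter; downFrom; foldl; length; upTo)
open import Data.Maybe using (Maybe; just; nothing)
open import Data.Product using (_×_; _,_; ∃-syntax)
open import Data.List.Membership.Propositional using (_∈_)
open import Data.List.Relation.Binary.Permutation.Propositional using (_↭_)
open import Relation.Nullary using (¬?; yes; no)
open import Relation.Binary.PropositionalEquality using (_≡_)
open import Data.Nat using (_<_)

-- Permutations are lists (σ₁ , … , σₙ) of naturals.

oneTo : ℕ → List ℕ
oneTo n = map suc (upTo n)

L : ℕ → List ℕ
L N = filter (λ x → ¬? (x ≟ ⌈ N /2⌉)) (map suc (downFrom N))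

I : List ℕ → List ℕ
I = map suc

I^ : ℕ → List ℕ → List ℕ
I^ k = map (k +_)

B' : ℕ → ℕ → List ℕ
B' m n = (⌈ (n + m) /2⌉ ∷ [])
       ++ I (L (m ∸ 1))
       ++ (1 ∷ [])
       ++ I^ m (L (n ∸ m))
       ++ ((⌊ m /2⌋ + 1) ∷ [])

-- σ(i) for 1-indexed i (0 outside the range)
apply : List ℕ → ℕ → ℕ
apply []       _             = 0
apply (x ∷ xs) 0             = 0
apply (x ∷ xs) 1             = x
apply (x ∷ xs) (suc (suc i)) = apply xs (suc i)

applyIter : List ℕ → ℕ → ℕ → ℕ
applyIter σ zero    i = i
applyIter σ (suc k) i = apply σ (applyIter σ k i)

IsPerm : ℕ → List ℕ → Set
IsPerm n σ = σ ↭ oneTo n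

-- σ is a permutation of {1..n} consisting of a single n-cycle:
-- the orbit of 1 under σ contains every element of {1..n}
IsCyclic : ℕ → List ℕ → Set
IsCyclic n σ = IsPerm n σ × (∀ j → j ∈ oneTo n → ∃[ k ] (k < n × applyIter σ k 1 ≡ j))

Tableau : Set
Tableau = List (List ℕ)

rowInsert : ℕ → List ℕ → Maybe ℕ × List ℕ
rowInsert x []       = nothing , (x ∷ [])
rowInsert x (y ∷ ys) with x <? y
... | yes _ = just y , (x ∷ ys)
... | no _  with rowInsert x ys
...   | b , r = b , (y ∷ r)

insertT : ℕ → Tableau → Tableau
insertT x []       = (x ∷ []) ∷ []
insertT x (r ∷ rs) with rowInsert x r
... | nothing , r' = r' ∷ rs
... | just y  , r' = r' ∷ insertT y rs

P : List ℕ → Tableau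
P σ = foldl (λ T x → insertT x T) [] σ

Γ : Tableau → List ℕ
Γ = map length

-- Write m = M + 1, n = m + N, a = m + ⌈N/2⌉ and b = 1 + ⌈M/2⌉, so that
-- B'(m,n) = a ⊕ I(L(M)) ⊕ (1) ⊕ I^m(L(N)) ⊕ (b).
--
-- Cycle: L(K+2) = (K+2) ⊕ I(L(K)) ⊕ (1), so by induction on K the orbit of the
-- middle position of a block of σ carrying a shifted copy of L(K) runs through the
-- whole block in K − 1 steps and ends at its last position.  The orbit of 1 thus
-- visits a, the block m+1 … n, then (as σ(n) = b) the block 2 … m.
--
-- Shape: a followed by the decreasing word I(L(M)) ⊕ (1) inserts as a single column
-- S over a.  The entries of I^m(L(N)) exceed S and arrive in decreasing order, so each
-- enters a second column at the top, pushing it down; once that column has M entries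
-- its bottom entry falls into the tableau below, which started as (a).  Finally b,
-- above 1 but below everything in the second column, pushes it down once more.  The
-- top M rows have length 2, and what lies below is the insertion tableau of a followed
-- by a decreasing word starting above a: a hook (2, 1, …, 1) with n − 2m rows of length 1.

module Submission where

open import Defs
open import Data.Bool using (true; false)
open import Data.List
  using (List; []; _∷_; _++_; _∷ʳ_; map; filter; foldl; downFrom; upTo; length; reverse; replicate; take; drop)
open import Data.List.Membership.Propositional using (_∈_)
open import Data.List.Properties
  using (++-assoc; ++-identityʳ; ∷ʳ-++; map-++; map-∘; map-cong; length-map; length-reverse; length-downFrom;
         length-take; length-drop; reverse-upTo; unfold-reverse; reverse-++; foldl-++; filter-++; filter-accept)
open import Data.List.Relation.Binary.Permutation.Propositional
  using (_↭_; ↭-refl; ↭-sym; ↭-trans; ↭-reflexive; prep; swap; module PermutationReasoning)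
import Data.List.Relation.Binary.Permutation.Propositional.Properties as ↭
open import Data.List.Relation.Unary.All using (All; []; _∷_)
import Data.List.Relation.Unary.All as All
import Data.List.Relation.Unary.All.Properties as Allₚ
open import Data.List.Relation.Unary.Any using (here; there)
open import Data.List.Relation.Unary.AllPairs using (AllPairs; []; _∷_)
import Data.List.Relation.Unary.AllPairs as AllPairs
import Data.List.Relation.Unary.AllPairs.Properties as AllPairsₚ
open import Data.Maybe using (just; nothing)
open import Data.Nat
  using (ℕ; zero; suc; _+_; _*_; _∸_; _≤_; _<_; _>_; _≡ᵇ_; _<?_; _≟_; z≤n; s≤s; z<s; s<s; s<s⁻¹; ⌊_/2⌋; ⌈_/2⌉)
open import Data.Nat.Properties
open import Data.Product using (_×_; _,_; proj₁; proj₂; ∃-syntax)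
open import Data.Sum using (_⊎_; inj₁; inj₂)
open import Function using (_∘_; flip)
open import Relation.Binary.Definitions using (tri<; tri≈; tri>)
open import Relation.Nullary using (Dec; ¬?; yes; no; contradiction)
open import Relation.Binary.PropositionalEquality
  using (_≡_; _≢_; refl; sym; trans; cong; cong₂; subst; module ≡-Reasoning)

Increasing Decreasing : List ℕ → Set
Increasing = AllPairs _<_
Decreasing = AllPairs _>_

infix 4 _≪_
_≪_ : List ℕ → List ℕ → Set
xs ≪ ys = All (λ y → All (_< y) xs) ys

≪-tailˡ : ∀ {x xs ys} → (x ∷ xs) ≪ ys → xs ≪ ys
≪-tailˡ = All.map All.tail

All-reverse : ∀ {A : Set} {P : A → Set} {xs} → All P xs → All P (reverse xs)
All-reverse {xs = xs} = ↭.All-resp-↭ (↭-sym (↭.↭-reverse xs))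

AllPairs-++⁻ : ∀ {A : Set} {R : A → A → Set} xs {ys} → AllPairs R (xs ++ ys) →
               AllPairs R xs × AllPairs R ys × All (λ x → All (R x) ys) xs
AllPairs-++⁻ []       Rys          = [] , Rys , []
AllPairs-++⁻ (x ∷ xs) (Rxxs ∷ Rxs) with AllPairs-++⁻ xs Rxs
... | Rxs′ , Rys , Rxsys = (Allₚ.++⁻ˡ xs Rxxs ∷ Rxs′) , Rys , (Allₚ.++⁻ʳ xs Rxxs ∷ Rxsys)

AllPairs-reverse : ∀ {A : Set} {R : A → A → Set} {xs} → AllPairs R xs → AllPairs (flip R) (reverse xs)
AllPairs-reverse {xs = []}     []           = []
AllPairs-reverse {xs = x ∷ xs} (Rxxs ∷ Rxs) rewrite unfold-reverse x xs =
  AllPairsₚ.++⁺ (AllPairs-reverse Rxs) ([] ∷ []) (All-reverse (All.map (_∷ []) Rxxs))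

length-∷ʳ : ∀ {A : Set} (xs : List A) x → length (xs ∷ʳ x) ≡ suc (length xs)
length-∷ʳ []       _ = refl
length-∷ʳ (_ ∷ xs) x = cong suc (length-∷ʳ xs x)

take-suc-drop : ∀ {A : Set} k (xs : List A) {q qs} → drop k xs ≡ q ∷ qs → take (suc k) xs ≡ take k xs ∷ʳ q
take-suc-drop zero    (x ∷ xs) refl = refl
take-suc-drop (suc k) (x ∷ xs) eq   = cong (x ∷_) (take-suc-drop k xs eq)

replicate-∷-++ : ∀ {A : Set} k (x : A) ys → replicate k x ++ x ∷ ys ≡ replicate (suc k) x ++ ys
replicate-∷-++ zero    x ys = refl
replicate-∷-++ (suc k) x ys = cong (x ∷_) (replicate-∷-++ k x ys)

⌈k+k+n/2⌉ : ∀ k n → ⌈ k + k + n /2⌉ ≡ k + ⌈ n /2⌉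
⌈k+k+n/2⌉ zero    n = refl
⌈k+k+n/2⌉ (suc k) n = trans (cong (λ j → ⌈ suc j + n /2⌉) (+-suc k k)) (cong suc (⌈k+k+n/2⌉ k n))

-- Insertion into tableaux with at most two columns

insertAll : Tableau → List ℕ → Tableau
insertAll = foldl (λ T x → insertT x T)

column : List ℕ → Tableau
column = map (_∷ [])

twoColumns : List ℕ → List ℕ → Tableau
twoColumns []      _       = []
twoColumns (s ∷ S) []      = (s ∷ []) ∷ twoColumns S []
twoColumns (s ∷ S) (e ∷ E) = (s ∷ e ∷ []) ∷ twoColumns S E

hook : ℕ → ℕ → List ℕ → Tableau
hook p q cs = (p ∷ q ∷ []) ∷ column cs

insertAll-++ : ∀ T xs ys → insertAll T (xs ++ ys) ≡ insertAll (insertAll T xs) ys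
insertAll-++ = foldl-++ (λ T x → insertT x T)

rowInsert-bump : ∀ {x y} ys → x < y → rowInsert x (y ∷ ys) ≡ (just y , x ∷ ys)
rowInsert-bump {x} {y} ys x<y with x <? y
... | yes _    = refl
... | no x≮y = contradiction x<y x≮y

rowInsert-append : ∀ {s x} → s < x → rowInsert x (s ∷ []) ≡ (nothing , s ∷ x ∷ [])
rowInsert-append {s} {x} s<x with x <? s
... | yes x<s = contradiction x<s (<-asym s<x)
... | no _    = refl

rowInsert-bumpSecond : ∀ {s x e} → s < x → x < e → rowInsert x (s ∷ e ∷ []) ≡ (just e , s ∷ x ∷ [])
rowInsert-bumpSecond {s} {x} s<x x<e with x <? s
... | yes x<s = contradiction x<s (<-asym s<x)
... | no _    rewrite rowInsert-bump [] x<e = refl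

insertT-bumping : ∀ {x y r r′} rs → rowInsert x r ≡ (just y , r′) → insertT x (r ∷ rs) ≡ r′ ∷ insertT y rs
insertT-bumping rs eq rewrite eq = refl

insertT-settling : ∀ {x r r′} rs → rowInsert x r ≡ (nothing , r′) → insertT x (r ∷ rs) ≡ r′ ∷ rs
insertT-settling rs eq rewrite eq = refl

insertT-column : ∀ {x} cs → Increasing (x ∷ cs) → insertT x (column cs) ≡ column (x ∷ cs)
insertT-column []       _                  = refl
insertT-column (c ∷ cs) ((x<c ∷ _) ∷ c∷cs↑) =
  trans (insertT-bumping (column cs) (rowInsert-bump [] x<c))
        (cong ((_ ∷ []) ∷_) (insertT-column cs c∷cs↑))

insertAll-column : ∀ xs cs → Increasing (reverse xs ++ cs) → insertAll (column cs) xs ≡ column (reverse xs ++ cs)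
insertAll-column []       cs _  = refl
insertAll-column (x ∷ xs) cs ↑ = begin
  insertAll (insertT x (column cs)) xs ≡⟨ cong (λ T → insertAll T xs) (insertT-column cs x∷cs↑) ⟩
  insertAll (column (x ∷ cs)) xs       ≡⟨ insertAll-column xs (x ∷ cs) ↑′ ⟩
  column (reverse xs ++ x ∷ cs)        ≡⟨ cong column (sym split) ⟩
  column (reverse (x ∷ xs) ++ cs)      ∎
  where
    open ≡-Reasoning
    split : reverse (x ∷ xs) ++ cs ≡ reverse xs ++ x ∷ cs
    split = trans (cong (_++ cs) (unfold-reverse x xs)) (∷ʳ-++ (reverse xs) x cs)
    ↑′ : Increasing (reverse xs ++ x ∷ cs)
    ↑′ = subst Increasing split ↑
    x∷cs↑ : Increasing (x ∷ cs)
    x∷cs↑ = proj₁ (proj₂ (AllPairs-++⁻ (reverse xs) ↑′))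

insertT-twoColumns-fill : ∀ {z s} S E U → length E ≤ length S → s < z → Increasing (z ∷ E) → S ≪ E →
                          insertT z (twoColumns (s ∷ S) E ++ U) ≡ twoColumns (s ∷ S) (z ∷ E) ++ U
insertT-twoColumns-fill S        []      U _         s<z _                  _ =
  insertT-settling (twoColumns S [] ++ U) (rowInsert-append s<z)
insertT-twoColumns-fill (s′ ∷ S) (e ∷ E) U (s≤s len) s<z ((z<e ∷ _) ∷ e∷E↑) ((s′<e ∷ _) ∷ S≪E) =
  trans (insertT-bumping (twoColumns (s′ ∷ S) E ++ U) (rowInsert-bumpSecond s<z z<e))
        (cong ((_ ∷ _ ∷ []) ∷_) (insertT-twoColumns-fill S E U len s′<e e∷E↑ (≪-tailˡ S≪E)))

insertT-twoColumns-push : ∀ {z s q} S E U → length E ≡ length S → s < z →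
                          Increasing (z ∷ E ∷ʳ q) → S ≪ (E ∷ʳ q) →
                          insertT z (twoColumns (s ∷ S) (E ∷ʳ q) ++ U) ≡ twoColumns (s ∷ S) (z ∷ E) ++ insertT q U
insertT-twoColumns-push []       []      U _   s<z ((z<q ∷ []) ∷ _)   _ =
  insertT-bumping U (rowInsert-bumpSecond s<z z<q)
insertT-twoColumns-push (s′ ∷ S) (e ∷ E) U len s<z ((z<e ∷ _) ∷ e∷E↑) ((s′<e ∷ _) ∷ S≪E) =
  trans (insertT-bumping (twoColumns (s′ ∷ S) (E ∷ʳ _) ++ U) (rowInsert-bumpSecond s<z z<e))
        (cong ((_ ∷ _ ∷ []) ∷_) (insertT-twoColumns-push S E U (suc-injective len) s′<e e∷E↑ (≪-tailˡ S≪E)))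

-- The hypotheses of one insertion step of insertAll-twoColumns, read off from those of the whole fold.
module TwoColumnStep {s S v} Q V (↓ : Decreasing (Q ++ v ∷ V)) (S≪ : (s ∷ S) ≪ (Q ++ v ∷ V)) where
  assoc : Q ∷ʳ v ++ V ≡ Q ++ v ∷ V
  assoc = ∷ʳ-++ Q v V

  ↓′ : Decreasing (Q ∷ʳ v ++ V)
  ↓′ = subst Decreasing (sym assoc) ↓

  S≪′ : (s ∷ S) ≪ (Q ∷ʳ v ++ V)
  S≪′ = subst (λ W → (s ∷ S) ≪ W) (sym assoc) S≪

  s<v : s < v
  s<v = All.head (All.head (Allₚ.++⁻ʳ Q S≪))

  v∷Q↑ : Increasing (v ∷ reverse Q)
  v∷Q↑ = subst Increasing (reverse-++ Q (v ∷ [])) (AllPairs-reverse (proj₁ (AllPairs-++⁻ (Q ∷ʳ v) ↓′)))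

  S≪Q : S ≪ reverse Q
  S≪Q = All-reverse (≪-tailˡ (Allₚ.++⁻ˡ Q S≪))

-- The second column is stored reversed, as Q.  Once it is as long as the first column,
-- each insertion pushes its bottom entry into U, so in the end the first k entries of Q ++ V are in U.
insertAll-twoColumns : ∀ {s S} V Q U k → length Q ≤ suc (length S) → length Q + length V ≡ suc (length S) + k →
                       Decreasing (Q ++ V) → (s ∷ S) ≪ (Q ++ V) →
                       insertAll (twoColumns (s ∷ S) (reverse Q) ++ U) V ≡
                       twoColumns (s ∷ S) (reverse (drop k (Q ++ V))) ++ insertAll U (take k (Q ++ V))
insertAll-twoColumns {s} {S} [] Q U zero _ _ _ _ =
  cong (λ E → twoColumns (s ∷ S) (reverse E) ++ U) (sym (++-identityʳ Q))
insertAll-twoColumns {s} {S} [] Q U (suc k) len total _ _ =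
  contradiction (subst (_≤ suc (length S)) (trans (sym (+-identityʳ (length Q))) total) len) (m+1+n≰m (suc (length S)))
insertAll-twoColumns {s} {S} (v ∷ V) Q U k len total ↓ S≪ with m≤n⇒m<n∨m≡n len
... | inj₁ (s≤s Q<S) = begin
  insertAll (insertT v (twoColumns (s ∷ S) (reverse Q) ++ U)) V
    ≡⟨ cong (λ T → insertAll T V) (insertT-twoColumns-fill S (reverse Q) U Q≤S s<v v∷Q↑ S≪Q) ⟩
  insertAll (twoColumns (s ∷ S) (v ∷ reverse Q) ++ U) V
    ≡⟨ cong (λ E → insertAll (twoColumns (s ∷ S) E ++ U) V) (sym (reverse-++ Q (v ∷ []))) ⟩
  insertAll (twoColumns (s ∷ S) (reverse (Q ∷ʳ v)) ++ U) V
    ≡⟨ insertAll-twoColumns V (Q ∷ʳ v) U k len′ total′ ↓′ S≪′ ⟩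
  twoColumns (s ∷ S) (reverse (drop k (Q ∷ʳ v ++ V))) ++ insertAll U (take k (Q ∷ʳ v ++ V))
    ≡⟨ cong (λ W → twoColumns (s ∷ S) (reverse (drop k W)) ++ insertAll U (take k W)) assoc ⟩
  twoColumns (s ∷ S) (reverse (drop k (Q ++ v ∷ V))) ++ insertAll U (take k (Q ++ v ∷ V)) ∎
  where
    open ≡-Reasoning
    open TwoColumnStep Q V ↓ S≪
    Q≤S : length (reverse Q) ≤ length S
    Q≤S = subst (_≤ length S) (sym (length-reverse Q)) Q<S
    len′ : length (Q ∷ʳ v) ≤ suc (length S)
    len′ = subst (_≤ suc (length S)) (sym (length-∷ʳ Q v)) (s≤s Q<S)
    total′ : length (Q ∷ʳ v) + length V ≡ suc (length S) + k
    total′ = trans (cong (_+ length V) (length-∷ʳ Q v)) (trans (sym (+-suc (length Q) (length V))) total)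
... | inj₂ Q≡S with Q | Q≡S
... | q ∷ Q′ | |Q′|≡|S| = begin
  insertAll (insertT v (twoColumns (s ∷ S) (reverse (q ∷ Q′)) ++ U)) V
    ≡⟨ cong (λ E → insertAll (insertT v (twoColumns (s ∷ S) E ++ U)) V) (unfold-reverse q Q′) ⟩
  insertAll (insertT v (twoColumns (s ∷ S) (reverse Q′ ∷ʳ q) ++ U)) V
    ≡⟨ cong (λ T → insertAll T V) (insertT-twoColumns-push S (reverse Q′) U Q′≡S s<v v∷Q∷ʳq↑ S≪Q∷ʳq) ⟩
  insertAll (twoColumns (s ∷ S) (v ∷ reverse Q′) ++ insertT q U) V
    ≡⟨ cong (λ E → insertAll (twoColumns (s ∷ S) E ++ insertT q U) V) (sym (reverse-++ Q′ (v ∷ []))) ⟩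
  insertAll (twoColumns (s ∷ S) (reverse (Q′ ∷ʳ v)) ++ insertT q U) V
    ≡⟨ insertAll-twoColumns V (Q′ ∷ʳ v) (insertT q U) (length V) len′ total′ Q′.↓′ Q′.S≪′ ⟩
  twoColumns (s ∷ S) (reverse (drop (length V) (Q′ ∷ʳ v ++ V)))
    ++ insertAll (insertT q U) (take (length V) (Q′ ∷ʳ v ++ V))
    ≡⟨ cong (λ W′ → twoColumns (s ∷ S) (reverse (drop (length V) W′)) ++ insertAll (insertT q U) (take (length V) W′))
            Q′.assoc ⟩
  twoColumns (s ∷ S) (reverse (drop (suc (length V)) W)) ++ insertAll U (take (suc (length V)) W)
    ≡⟨ cong (λ j → twoColumns (s ∷ S) (reverse (drop j W)) ++ insertAll U (take j W)) (sym k≡|V|) ⟩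
  twoColumns (s ∷ S) (reverse (drop k W)) ++ insertAll U (take k W) ∎
  where
    open ≡-Reasoning
    open TwoColumnStep (q ∷ Q′) V ↓ S≪
    W : List ℕ
    W = q ∷ Q′ ++ v ∷ V
    k≡|V| : k ≡ suc (length V)
    k≡|V| = sym (+-cancelˡ-≡ (length S) _ _
              (trans (cong (_+ suc (length V)) (sym (suc-injective |Q′|≡|S|))) (suc-injective total)))
    v∷Q∷ʳq↑ : Increasing (v ∷ reverse Q′ ∷ʳ q)
    v∷Q∷ʳq↑ = subst (λ E → Increasing (v ∷ E)) (unfold-reverse q Q′) v∷Q↑
    S≪Q∷ʳq : S ≪ reverse Q′ ∷ʳ q
    S≪Q∷ʳq = subst (S ≪_) (unfold-reverse q Q′) S≪Q
    module Q′ = TwoColumnStep Q′ V (AllPairs.tail ↓) (All.tail S≪)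
    Q′≡S : length (reverse Q′) ≡ length S
    Q′≡S = trans (length-reverse Q′) (suc-injective |Q′|≡|S|)
    |Q′∷ʳv| : length (Q′ ∷ʳ v) ≡ suc (length S)
    |Q′∷ʳv| = trans (length-∷ʳ Q′ v) |Q′|≡|S|
    len′ : length (Q′ ∷ʳ v) ≤ suc (length S)
    len′ = ≤-reflexive |Q′∷ʳv|
    total′ : length (Q′ ∷ʳ v) + length V ≡ suc (length S) + length V
    total′ = cong (_+ length V) |Q′∷ʳv|

twoColumns-[] : ∀ S → twoColumns S [] ≡ column S
twoColumns-[] []      = refl
twoColumns-[] (s ∷ S) = cong ((s ∷ []) ∷_) (twoColumns-[] S)

Γ-column : ∀ cs → Γ (column cs) ≡ replicate (length cs) 1
Γ-column []       = refl
Γ-column (_ ∷ cs) = cong (1 ∷_) (Γ-column cs)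

Γ-twoColumns : ∀ S E → length E ≡ length S → Γ (twoColumns S E) ≡ replicate (length S) 2
Γ-twoColumns []      []      _   = refl
Γ-twoColumns (_ ∷ S) (_ ∷ E) len = cong (2 ∷_) (Γ-twoColumns S E (suc-injective len))

insertT-hook-below : ∀ {p q v} cs → v < p → Increasing (p ∷ cs) → insertT v (hook p q cs) ≡ hook v q (p ∷ cs)
insertT-hook-below cs v<p p∷cs↑ =
  trans (insertT-bumping (column cs) (rowInsert-bump (_ ∷ []) v<p)) (cong (_ ∷_) (insertT-column cs p∷cs↑))

insertT-hook-between : ∀ {p q v} cs → p < v → v < q → Increasing (q ∷ cs) →
                       insertT v (hook p q cs) ≡ hook p v (q ∷ cs)
insertT-hook-between cs p<v v<q q∷cs↑ =
  trans (insertT-bumping (column cs) (rowInsert-bumpSecond p<v v<q)) (cong (_ ∷_) (insertT-column cs q∷cs↑))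

-- Entries above p replace q in the first row.  Once an entry falls below p, so do all later
-- ones, and they replace p instead; the disjunction says which of the two phases we are in.
Γ-insertAll-hook : ∀ ys p q cs → p < q → Increasing (p ∷ cs) → Decreasing (q ∷ ys) → All (_≢ p) ys →
                   Increasing (q ∷ cs) ⊎ All (_< p) ys →
                   Γ (insertAll (hook p q cs) ys) ≡ 2 ∷ replicate (length ys + length cs) 1
Γ-insertAll-hook []       p q cs _   _ _ _ _ = cong (2 ∷_) (Γ-column cs)
Γ-insertAll-hook (y ∷ ys) p q cs p<q p∷cs↑@(p<cs ∷ _) ((y<q ∷ ys<q) ∷ y∷ys↓@(ys<y ∷ _)) (y≢p ∷ ys≢p) q∷cs↑⊎ys<p
  with <-cmp y p | q∷cs↑⊎ys<p
... | tri< y<p _ _ | _ = begin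
  Γ (insertAll (insertT y (hook p q cs)) ys)
    ≡⟨ cong (λ T → Γ (insertAll T ys)) (insertT-hook-below cs y<p p∷cs↑) ⟩
  Γ (insertAll (hook y q (p ∷ cs)) ys)
    ≡⟨ Γ-insertAll-hook ys y q (p ∷ cs) (<-trans y<p p<q) y∷p∷cs↑ (ys<q ∷ AllPairs.tail y∷ys↓) ys≢y (inj₂ ys<y) ⟩
  2 ∷ replicate (length ys + suc (length cs)) 1
    ≡⟨ cong (λ k → 2 ∷ replicate k 1) (+-suc (length ys) (length cs)) ⟩
  2 ∷ replicate (suc (length ys) + length cs) 1 ∎
  where
    open ≡-Reasoning
    y∷p∷cs↑ : Increasing (y ∷ p ∷ cs)
    y∷p∷cs↑ = (y<p ∷ All.map (<-trans y<p) p<cs) ∷ p∷cs↑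
    ys≢y : All (_≢ y) ys
    ys≢y = All.map (λ z<y z≡y → <-irrefl z≡y z<y) ys<y
... | tri≈ _ y≡p _ | _ = contradiction y≡p y≢p
... | tri> _ _ p<y | inj₂ (y<p ∷ _) = contradiction y<p (<-asym p<y)
... | tri> _ _ p<y | inj₁ q∷cs↑@(q<cs ∷ _) = begin
  Γ (insertAll (insertT y (hook p q cs)) ys)
    ≡⟨ cong (λ T → Γ (insertAll T ys)) (insertT-hook-between cs p<y y<q q∷cs↑) ⟩
  Γ (insertAll (hook p y (q ∷ cs)) ys)
    ≡⟨ Γ-insertAll-hook ys p y (q ∷ cs) p<y p∷q∷cs↑ y∷ys↓ ys≢p (inj₁ y∷q∷cs↑) ⟩
  2 ∷ replicate (length ys + suc (length cs)) 1
    ≡⟨ cong (λ k → 2 ∷ replicate k 1) (+-suc (length ys) (length cs)) ⟩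
  2 ∷ replicate (suc (length ys) + length cs) 1 ∎
  where
    open ≡-Reasoning
    p∷q∷cs↑ : Increasing (p ∷ q ∷ cs)
    p∷q∷cs↑ = (p<q ∷ p<cs) ∷ q∷cs↑
    y∷q∷cs↑ : Increasing (y ∷ q ∷ cs)
    y∷q∷cs↑ = (y<q ∷ All.map (<-trans y<q) q<cs) ∷ q∷cs↑

Γ-P-hook : ∀ {p y} ys → p < y → Decreasing (y ∷ ys) → All (_≢ p) ys →
           Γ (P (p ∷ y ∷ ys)) ≡ 2 ∷ replicate (length ys) 1
Γ-P-hook {p} {y} ys p<y y∷ys↓ ys≢p = begin
  Γ (insertAll (insertT y ((p ∷ []) ∷ [])) ys)
    ≡⟨ cong (λ T → Γ (insertAll T ys)) (insertT-settling [] (rowInsert-append p<y)) ⟩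
  Γ (insertAll (hook p y []) ys)
    ≡⟨ Γ-insertAll-hook ys p y [] p<y ([] ∷ []) y∷ys↓ ys≢p (inj₁ ([] ∷ [])) ⟩
  2 ∷ replicate (length ys + 0) 1
    ≡⟨ cong (λ k → 2 ∷ replicate k 1) (+-identityʳ (length ys)) ⟩
  2 ∷ replicate (length ys) 1 ∎
  where open ≡-Reasoning

-- The sequences L(K)

downToOne : ℕ → List ℕ
downToOne k = map suc (downFrom k)

downToOne-suc : ∀ k → downToOne (suc k) ≡ map suc (downToOne k) ∷ʳ 1
downToOne-suc zero    = refl
downToOne-suc (suc k) = cong (suc (suc k) ∷_) (downToOne-suc k)

downToOne-+ : ∀ j k → downToOne (j + k) ≡ map (k +_) (downToOne j) ++ downToOne k
downToOne-+ zero    k = refl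
downToOne-+ (suc j) k = cong₂ _∷_ (trans (cong suc (+-comm j k)) (sym (+-suc k j))) (downToOne-+ j k)

downToOne-↭-oneTo : ∀ k → downToOne k ↭ oneTo k
downToOne-↭-oneTo k = ↭.map⁺ suc (↭-trans (↭-reflexive (sym (reverse-upTo k))) (↭.↭-reverse (upTo k)))

downToOne-bounded : ∀ k → All (λ x → 0 < x × x ≤ k) (downToOne k)
downToOne-bounded zero    = []
downToOne-bounded (suc k) = (z<s , ≤-refl) ∷ All.map (λ (0<x , x≤k) → 0<x , m≤n⇒m≤1+n x≤k) (downToOne-bounded k)

downToOne-decreasing : ∀ k → Decreasing (downToOne k)
downToOne-decreasing zero    = []
downToOne-decreasing (suc k) = All.map (λ (_ , x≤k) → s≤s x≤k) (downToOne-bounded k) ∷ downToOne-decreasing k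

filter-≢-map-suc : ∀ h xs → filter (λ x → ¬? (x ≟ suc h)) (map suc xs) ≡
                             map suc (filter (λ x → ¬? (x ≟ h)) xs)
filter-≢-map-suc h []       = refl
filter-≢-map-suc h (x ∷ xs) with x ≡ᵇ h
... | true  = filter-≢-map-suc h xs
... | false = cong (suc x ∷_) (filter-≢-map-suc h xs)

L-suc-suc : ∀ k → L (suc (suc (suc k))) ≡ suc (suc (suc k)) ∷ map suc (L (suc k)) ∷ʳ 1
L-suc-suc k = begin
  filter ≢h′? (downToOne (suc (suc (suc k))))
    ≡⟨ filter-accept ≢h′? top≢h′ ⟩
  suc (suc (suc k)) ∷ filter ≢h′? (downToOne (suc (suc k)))
    ≡⟨ cong (λ xs → suc (suc (suc k)) ∷ filter ≢h′? xs) (downToOne-suc (suc k)) ⟩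
  suc (suc (suc k)) ∷ filter ≢h′? (map suc (downToOne (suc k)) ∷ʳ 1)
    ≡⟨ cong (suc (suc (suc k)) ∷_) (filter-++ ≢h′? (map suc (downToOne (suc k))) (1 ∷ [])) ⟩
  suc (suc (suc k)) ∷ filter ≢h′? (map suc (downToOne (suc k))) ∷ʳ 1
    ≡⟨ cong (λ xs → suc (suc (suc k)) ∷ xs ∷ʳ 1) (filter-≢-map-suc h (downToOne (suc k))) ⟩
  suc (suc (suc k)) ∷ map suc (L (suc k)) ∷ʳ 1 ∎
  where
    open ≡-Reasoning
    h : ℕ
    h = ⌈ suc k /2⌉
    ≢h′? : (x : ℕ) → Dec (x ≢ suc h)
    ≢h′? x = ¬? (x ≟ suc h)
    top≢h′ : suc (suc (suc k)) ≢ suc h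
    top≢h′ eq = <-irrefl (sym eq) (s≤s (s≤s (⌈n/2⌉≤n (suc k))))

L-↭ : ∀ k → L (suc k) ∷ʳ ⌈ suc k /2⌉ ↭ downToOne (suc k)
L-↭ zero          = ↭-refl
L-↭ (suc zero)    = ↭-refl
L-↭ (suc (suc k)) = begin
  L (suc (suc (suc k))) ∷ʳ suc h
    ≡⟨ cong (_∷ʳ suc h) (L-suc-suc k) ⟩
  suc (suc (suc k)) ∷ map suc (L (suc k)) ∷ʳ 1 ∷ʳ suc h
    ≡⟨ cong (suc (suc (suc k)) ∷_) (++-assoc (map suc (L (suc k))) (1 ∷ []) (suc h ∷ [])) ⟩
  suc (suc (suc k)) ∷ map suc (L (suc k)) ++ 1 ∷ suc h ∷ []
    ↭⟨ prep _ (↭.++⁺ˡ (map suc (L (suc k))) (swap 1 (suc h) ↭-refl)) ⟩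
  suc (suc (suc k)) ∷ map suc (L (suc k)) ++ suc h ∷ 1 ∷ []
    ≡⟨ cong (suc (suc (suc k)) ∷_) (sym (++-assoc (map suc (L (suc k))) (suc h ∷ []) (1 ∷ []))) ⟩
  suc (suc (suc k)) ∷ map suc (L (suc k)) ∷ʳ suc h ∷ʳ 1
    ≡⟨ cong (λ xs → suc (suc (suc k)) ∷ xs ∷ʳ 1) (sym (map-++ suc (L (suc k)) (h ∷ []))) ⟩
  suc (suc (suc k)) ∷ map suc (L (suc k) ∷ʳ h) ∷ʳ 1
    ↭⟨ prep _ (↭.++⁺ʳ (1 ∷ []) (↭.map⁺ suc (L-↭ k))) ⟩
  suc (suc (suc k)) ∷ map suc (downToOne (suc k)) ∷ʳ 1
    ≡⟨ cong (suc (suc (suc k)) ∷_) (sym (downToOne-suc (suc k))) ⟩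
  downToOne (suc (suc (suc k))) ∎
  where
    open PermutationReasoning
    h : ℕ
    h = ⌈ suc k /2⌉

length-L : ∀ k → length (L (suc k)) ≡ k
length-L k = suc-injective (begin
  suc (length (L (suc k)))                ≡⟨ sym (length-∷ʳ (L (suc k)) ⌈ suc k /2⌉) ⟩
  length (L (suc k) ∷ʳ ⌈ suc k /2⌉)       ≡⟨ ↭.↭-length (L-↭ k) ⟩
  length (downToOne (suc k))              ≡⟨ length-map suc (downFrom (suc k)) ⟩
  length (downFrom (suc k))               ≡⟨ length-downFrom (suc k) ⟩
  suc k                                   ∎)
  where open ≡-Reasoning

L-bounded : ∀ K → All (λ x → 0 < x × x ≤ K) (L K)
L-bounded K = Allₚ.filter⁺ _ (downToOne-bounded K)

L-decreasing : ∀ K → Decreasing (L K)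
L-decreasing K = AllPairsₚ.filter⁺ _ (downToOne-decreasing K)

L-avoids-middle : ∀ K → All (_≢ ⌈ K /2⌉) (L K)
L-avoids-middle K = Allₚ.all-filter (λ x → ¬? (x ≟ ⌈ K /2⌉)) (downToOne K)

L-head : ∀ k → ∃[ tl ] (L (suc (suc k)) ≡ suc (suc k) ∷ tl)
L-head zero    = [] , refl
L-head (suc k) = _ , L-suc-suc k

apply-++ˡ : ∀ xs ys i → suc i ≤ length xs → apply (xs ++ ys) (suc i) ≡ apply xs (suc i)
apply-++ˡ (x ∷ xs) ys zero    _         = refl
apply-++ˡ (x ∷ xs) ys (suc i) (s≤s i<) = apply-++ˡ xs ys i i<

apply-++ʳ : ∀ xs ys i → apply (xs ++ ys) (suc (length xs + i)) ≡ apply ys (suc i)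
apply-++ʳ []       ys i = refl
apply-++ʳ (x ∷ xs) ys i = apply-++ʳ xs ys i

apply-map : ∀ f xs i → suc i ≤ length xs → apply (map f xs) (suc i) ≡ f (apply xs (suc i))
apply-map f (x ∷ xs) zero    _         = refl
apply-map f (x ∷ xs) (suc i) (s≤s i<) = apply-map f xs i i<

apply-L-first : ∀ k → apply (L (suc (suc (suc k)))) 1 ≡ suc (suc (suc k))
apply-L-first k = cong (λ xs → apply xs 1) (L-suc-suc k)

apply-L-inner : ∀ k i → suc i < suc k → apply (L (suc (suc (suc k)))) (suc (suc i)) ≡ suc (apply (L (suc k)) (suc i))
apply-L-inner k i i<k = begin
  apply (L (suc (suc (suc k)))) (suc (suc i)) ≡⟨ cong (λ xs → apply xs (suc (suc i))) (L-suc-suc k) ⟩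
  apply (map suc (L (suc k)) ∷ʳ 1) (suc i)    ≡⟨ apply-++ˡ (map suc (L (suc k))) (1 ∷ []) i i≤|sucL| ⟩
  apply (map suc (L (suc k))) (suc i)         ≡⟨ apply-map suc (L (suc k)) i i≤|L| ⟩
  suc (apply (L (suc k)) (suc i))             ∎
  where
    open ≡-Reasoning
    i≤|L| : suc i ≤ length (L (suc k))
    i≤|L| = subst (suc i ≤_) (sym (length-L k)) (s<s⁻¹ i<k)
    i≤|sucL| : suc i ≤ length (map suc (L (suc k)))
    i≤|sucL| = subst (suc i ≤_) (sym (length-map suc (L (suc k)))) i≤|L|

apply-L-last : ∀ k → apply (L (suc (suc (suc k)))) (suc (suc k)) ≡ 1
apply-L-last k = begin
  apply (L (suc (suc (suc k)))) (suc (suc k))          ≡⟨ cong (λ xs → apply xs (suc (suc k))) (L-suc-suc k) ⟩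
  apply (map suc (L (suc k)) ∷ʳ 1) (suc k)             ≡⟨ cong (λ j → apply (map suc (L (suc k)) ∷ʳ 1) (suc j)) (sym k≡|L|+0) ⟩
  apply (map suc (L (suc k)) ∷ʳ 1) (suc (length (map suc (L (suc k))) + 0))
                                                       ≡⟨ apply-++ʳ (map suc (L (suc k))) (1 ∷ []) 0 ⟩
  1                                                    ∎
  where
    open ≡-Reasoning
    k≡|L|+0 : length (map suc (L (suc k))) + 0 ≡ k
    k≡|L|+0 = trans (+-identityʳ _) (trans (length-map suc (L (suc k))) (length-L k))

-- Orbits

orbit : List ℕ → ℕ → ℕ → List ℕ
orbit σ x zero    = []
orbit σ x (suc k) = x ∷ orbit σ (apply σ x) k

applyIter-suc : ∀ σ k x → applyIter σ (suc k) x ≡ applyIter σ k (apply σ x)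
applyIter-suc σ zero    x = refl
applyIter-suc σ (suc k) x = cong (apply σ) (applyIter-suc σ k x)

orbit-+ : ∀ σ x k l → orbit σ x (k + l) ≡ orbit σ x k ++ orbit σ (applyIter σ k x) l
orbit-+ σ x zero    l = refl
orbit-+ σ x (suc k) l = cong (x ∷_) (trans (orbit-+ σ (apply σ x) k l)
                                           (cong (λ y → orbit σ (apply σ x) k ++ orbit σ y l) (sym (applyIter-suc σ k x))))

∈-orbit : ∀ σ x k {y} → y ∈ orbit σ x k → ∃[ i ] (i < k × applyIter σ i x ≡ y)
∈-orbit σ x (suc k) (here refl) = 0 , z<s , refl
∈-orbit σ x (suc k) (there y∈) with ∈-orbit σ (apply σ x) k y∈
... | i , i<k , eq = suc i , s<s i<k , trans (applyIter-suc σ i x) eq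

AgreesWithL : List ℕ → ℕ → ℕ → Set
AgreesWithL σ off K = ∀ i → suc i < K → apply σ (off + suc i) ≡ off + apply (L K) (suc i)

map-+-downToOne-suc : ∀ off k → map (off +_) (downToOne (suc k)) ≡ map (suc off +_) (downToOne k) ∷ʳ (off + 1)
map-+-downToOne-suc off k = begin
  map (off +_) (downToOne (suc k))                   ≡⟨ cong (map (off +_)) (downToOne-suc k) ⟩
  map (off +_) (map suc (downToOne k) ∷ʳ 1)          ≡⟨ map-++ (off +_) (map suc (downToOne k)) (1 ∷ []) ⟩
  map (off +_) (map suc (downToOne k)) ∷ʳ (off + 1)  ≡⟨ cong (_∷ʳ (off + 1)) (sym (map-∘ (downToOne k))) ⟩
  map (λ y → off + suc y) (downToOne k) ∷ʳ (off + 1) ≡⟨ cong (_∷ʳ (off + 1)) (map-cong (+-suc off) (downToOne k)) ⟩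
  map (suc off +_) (downToOne k) ∷ʳ (off + 1)        ∎
  where open ≡-Reasoning

AgreesWithL-inner : ∀ σ k off → AgreesWithL σ off (suc (suc (suc k))) → AgreesWithL σ (suc off) (suc k)
AgreesWithL-inner σ k off agrees i i<K = begin
  apply σ (suc off + suc i)                         ≡⟨ cong (apply σ) (sym (+-suc off (suc i))) ⟩
  apply σ (off + suc (suc i))                       ≡⟨ agrees (suc i) (m<n⇒m<1+n (s<s i<K)) ⟩
  off + apply (L (suc (suc (suc k)))) (suc (suc i)) ≡⟨ cong (off +_) (apply-L-inner k i i<K) ⟩
  off + suc (apply (L (suc k)) (suc i))             ≡⟨ +-suc off _ ⟩
  suc off + apply (L (suc k)) (suc i)               ∎
  where open ≡-Reasoning

-- The inner positions of a block for L(K+2) form a block for L(K) (AgreesWithL-inner); after it the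
-- orbit leaves through off + K + 1 ↦ off + 1 ↦ off + K + 2 (apply-L-last, apply-L-first).
orbit-AgreesWithL : ∀ σ k off → AgreesWithL σ off (suc k) →
                    applyIter σ k (off + ⌈ suc k /2⌉) ≡ off + suc k ×
                    orbit σ (off + ⌈ suc k /2⌉) (suc k) ↭ map (off +_) (downToOne (suc k))
orbit-AgreesWithL σ zero          off _      = refl , ↭-refl
orbit-AgreesWithL σ (suc zero)    off agrees =
  step , subst (λ y → off + 1 ∷ y ∷ [] ↭ off + 2 ∷ off + 1 ∷ []) (sym step) (swap _ _ ↭-refl)
  where
    step : apply σ (off + 1) ≡ off + 2
    step = agrees 0 ≤-refl
orbit-AgreesWithL σ (suc (suc k)) off agrees rewrite +-suc off ⌈ suc k /2⌉ = last , perm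
  where
    K x : ℕ
    K = suc k
    x = suc off + ⌈ K /2⌉
    ih : applyIter σ k x ≡ suc off + K × orbit σ x K ↭ map (suc off +_) (downToOne K)
    ih = orbit-AgreesWithL σ k (suc off) (AgreesWithL-inner σ k off agrees)
    afterK : applyIter σ K x ≡ off + 1
    afterK = begin
      apply σ (applyIter σ k x)             ≡⟨ cong (apply σ) (proj₁ ih) ⟩
      apply σ (suc off + K)                 ≡⟨ cong (apply σ) (sym (+-suc off K)) ⟩
      apply σ (off + suc K)                 ≡⟨ agrees K ≤-refl ⟩
      off + apply (L (suc (suc K))) (suc K) ≡⟨ cong (off +_) (apply-L-last k) ⟩
      off + 1                               ∎
      where open ≡-Reasoning
    top : apply σ (off + 1) ≡ off + suc (suc K)
    top = trans (agrees 0 (s≤s (s≤s z≤n))) (cong (off +_) (apply-L-first k))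
    last : applyIter σ (suc K) x ≡ off + suc (suc K)
    last = trans (cong (apply σ) afterK) top
    perm : orbit σ x (suc (suc K)) ↭ map (off +_) (downToOne (suc (suc K)))
    perm = begin
      orbit σ x (suc (suc K))                          ≡⟨ cong (orbit σ x) (+-comm 2 K) ⟩
      orbit σ x (K + 2)                                ≡⟨ orbit-+ σ x K 2 ⟩
      orbit σ x K ++ orbit σ (applyIter σ K x) 2       ≡⟨ cong (λ y → orbit σ x K ++ orbit σ y 2) afterK ⟩
      orbit σ x K ++ off + 1 ∷ apply σ (off + 1) ∷ []  ≡⟨ cong (λ y → orbit σ x K ++ off + 1 ∷ y ∷ []) top ⟩
      orbit σ x K ++ off + 1 ∷ off + suc (suc K) ∷ []  ↭⟨ ↭.++⁺ˡ (orbit σ x K) (swap _ _ ↭-refl) ⟩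
      orbit σ x K ++ off + suc (suc K) ∷ off + 1 ∷ []  ↭⟨ ↭.shift (off + suc (suc K)) (orbit σ x K) (off + 1 ∷ []) ⟩
      off + suc (suc K) ∷ orbit σ x K ∷ʳ (off + 1)     ↭⟨ prep _ (↭.++⁺ʳ (off + 1 ∷ []) (proj₂ ih)) ⟩
      off + suc (suc K) ∷ map (suc off +_) (downToOne K) ∷ʳ (off + 1)
                                                       ≡⟨ cong (off + suc (suc K) ∷_) (sym (map-+-downToOne-suc off K)) ⟩
      map (off +_) (downToOne (suc (suc K)))           ∎
      where open PermutationReasoning

-- B'(m,n) for m = M′ + 2 and n = m + (m + r): here cs = I(L(m − 1)), X = I^m(L(n − m)), and ρ is σ without its head.
module Construction (M′ r : ℕ) where

  M m N n a b : ℕ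
  M = suc M′
  m = suc M
  N = m + r
  n = m + N
  a = m + ⌈ N /2⌉
  b = suc ⌈ M /2⌉

  cs X ρ σ : List ℕ
  cs = map suc (L M)
  X  = map (m +_) (L N)
  ρ  = cs ++ 1 ∷ X ++ b ∷ []
  σ  = a ∷ ρ

  B'≡σ : B' m n ≡ σ
  B'≡σ = begin
    ⌈ n + m /2⌉ ∷ cs ++ 1 ∷ map (m +_) (L (n ∸ m)) ++ (⌊ m /2⌋ + 1) ∷ []
      ≡⟨ cong (λ h → h ∷ cs ++ 1 ∷ map (m +_) (L (n ∸ m)) ++ (⌊ m /2⌋ + 1) ∷ []) ⌈n+m/2⌉≡a ⟩
    a ∷ cs ++ 1 ∷ map (m +_) (L (n ∸ m)) ++ (⌊ m /2⌋ + 1) ∷ []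
      ≡⟨ cong (λ k → a ∷ cs ++ 1 ∷ map (m +_) (L k) ++ (⌊ m /2⌋ + 1) ∷ []) (m+n∸m≡n m N) ⟩
    a ∷ cs ++ 1 ∷ X ++ (⌊ m /2⌋ + 1) ∷ []
      ≡⟨ cong (λ c → a ∷ cs ++ 1 ∷ X ++ c ∷ []) (+-comm ⌈ M /2⌉ 1) ⟩
    σ ∎
    where
      open ≡-Reasoning
      ⌈n+m/2⌉≡a : ⌈ n + m /2⌉ ≡ a
      ⌈n+m/2⌉≡a = trans (cong ⌈_/2⌉ (trans (+-comm n m) (sym (+-assoc m m N)))) (⌈k+k+n/2⌉ m N)

  length-cs : length cs ≡ M′
  length-cs = trans (length-map suc (L M)) (length-L M′)

  length-X : length X ≡ M + r
  length-X = trans (length-map (m +_) (L N)) (length-L (M + r))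

  cs-bounded : All (λ c → 1 < c × c ≤ m) cs
  cs-bounded = Allₚ.map⁺ (All.map (λ (0<c , c≤M) → s<s 0<c , s≤s c≤M) (L-bounded M))

  cs-decreasing : Decreasing cs
  cs-decreasing = AllPairsₚ.map⁺ (AllPairs.map s<s (L-decreasing M))

  X-above : All (m <_) X
  X-above = Allₚ.map⁺ (All.map (λ (0<x , _) → m<m+n m 0<x) (L-bounded N))

  X-decreasing : Decreasing X
  X-decreasing = AllPairsₚ.map⁺ (AllPairs.map (+-monoʳ-< m) (L-decreasing N))

  X-avoids-a : All (_≢ a) X
  X-avoids-a = Allₚ.map⁺ (All.map (λ x≢h m+x≡a → x≢h (+-cancelˡ-≡ m _ _ m+x≡a)) (L-avoids-middle N))

  a<n : a < n
  a<n = +-monoʳ-< m (⌈n/2⌉<n (M′ + r))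

  b≤m : b ≤ m
  b≤m = s≤s (⌈n/2⌉≤n M)

  σ-agrees-cs : AgreesWithL σ 1 M
  σ-agrees-cs i i<M = trans (apply-++ˡ cs (1 ∷ X ++ b ∷ []) i (subst (suc i ≤_) (sym length-cs) i<M′))
                            (apply-map suc (L M) i (subst (suc i ≤_) (sym (length-L M′)) i<M′))
    where
      i<M′ : suc i ≤ M′
      i<M′ = s<s⁻¹ i<M

  σ-agrees-X : AgreesWithL σ m N
  σ-agrees-X i i<N = begin
    apply σ (m + suc i)                ≡⟨ cong (λ k → apply ρ (suc (k + suc i))) (sym length-cs) ⟩
    apply ρ (suc (length cs + suc i))  ≡⟨ apply-++ʳ cs (1 ∷ X ++ b ∷ []) (suc i) ⟩
    apply (X ++ b ∷ []) (suc i)        ≡⟨ apply-++ˡ X (b ∷ []) i (subst (suc i ≤_) (sym length-X) i<|X|) ⟩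
    apply X (suc i)                    ≡⟨ apply-map (m +_) (L N) i (subst (suc i ≤_) (sym (length-L (M + r))) i<|X|) ⟩
    m + apply (L N) (suc i)            ∎
    where
      open ≡-Reasoning
      i<|X| : suc i ≤ M + r
      i<|X| = s<s⁻¹ i<N

  σ-at-n : apply σ n ≡ b
  σ-at-n = begin
    apply σ n                                     ≡⟨ cong (λ k → apply ρ (suc k)) n-split ⟩
    apply ρ (suc (length cs + suc (length X + 0))) ≡⟨ apply-++ʳ cs (1 ∷ X ++ b ∷ []) (suc (length X + 0)) ⟩
    apply (X ++ b ∷ []) (suc (length X + 0))       ≡⟨ apply-++ʳ X (b ∷ []) 0 ⟩
    b                                              ∎
    where
      open ≡-Reasoning
      n-split : M′ + N ≡ length cs + suc (length X + 0)
      n-split = sym (cong₂ (λ i j → i + suc j) length-cs (trans (+-identityʳ (length X)) length-X))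

  target : List ℕ
  target = 1 ∷ map (m +_) (downToOne N) ++ map suc (downToOne M)

  target-↭-oneTo : target ↭ oneTo n
  target-↭-oneTo = begin
    1 ∷ map (m +_) (downToOne N) ++ map suc (downToOne M)    ↭⟨ ↭.∷↭∷ʳ 1 _ ⟩
    (map (m +_) (downToOne N) ++ map suc (downToOne M)) ∷ʳ 1 ≡⟨ ++-assoc (map (m +_) (downToOne N)) _ (1 ∷ []) ⟩
    map (m +_) (downToOne N) ++ map suc (downToOne M) ∷ʳ 1   ≡⟨ cong (map (m +_) (downToOne N) ++_) (sym (downToOne-suc M)) ⟩
    map (m +_) (downToOne N) ++ downToOne m                  ≡⟨ sym (downToOne-+ N m) ⟩
    downToOne (N + m)                                        ≡⟨ cong downToOne (+-comm N m) ⟩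
    downToOne n                                              ↭⟨ downToOne-↭-oneTo n ⟩
    oneTo n                                                  ∎
    where open PermutationReasoning

  orbit-σ : orbit σ 1 n ↭ target
  orbit-σ = begin
    1 ∷ orbit σ a (M + N)                            ≡⟨ cong (λ k → 1 ∷ orbit σ a k) (+-comm M N) ⟩
    1 ∷ orbit σ a (N + M)                            ≡⟨ cong (1 ∷_) (orbit-+ σ a N M) ⟩
    1 ∷ orbit σ a N ++ orbit σ (applyIter σ N a) M  ≡⟨ cong (λ y → 1 ∷ orbit σ a N ++ orbit σ y M) through-X ⟩
    1 ∷ orbit σ a N ++ orbit σ b M                   ↭⟨ prep 1 (↭.++⁺ (proj₂ X-block) (proj₂ cs-block)) ⟩
    target                                           ∎
    where
      open PermutationReasoning
      X-block : applyIter σ (M + r) a ≡ n × orbit σ a N ↭ map (m +_) (downToOne N)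
      X-block = orbit-AgreesWithL σ (M + r) m σ-agrees-X
      cs-block : applyIter σ M′ b ≡ m × orbit σ b M ↭ map suc (downToOne M)
      cs-block = orbit-AgreesWithL σ M′ 1 σ-agrees-cs
      through-X : applyIter σ N a ≡ b
      through-X = trans (cong (apply σ) (proj₁ X-block)) σ-at-n

  σ-↭-oneTo : σ ↭ oneTo n
  σ-↭-oneTo = begin
    (a ∷ cs) ++ 1 ∷ X ++ b ∷ []       ↭⟨ ↭.shift 1 (a ∷ cs) (X ++ b ∷ []) ⟩
    1 ∷ (a ∷ cs) ++ X ++ b ∷ []       ↭⟨ prep 1 (↭.shifts (a ∷ cs) X) ⟩
    1 ∷ X ++ a ∷ cs ++ b ∷ []         ≡⟨ cong (1 ∷_) (sym (∷ʳ-++ X a (cs ∷ʳ b))) ⟩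
    1 ∷ X ∷ʳ a ++ cs ∷ʳ b             ↭⟨ prep 1 (↭.++⁺ X∷ʳa↭ cs∷ʳb↭) ⟩
    target                            ↭⟨ target-↭-oneTo ⟩
    oneTo n                           ∎
    where
      open PermutationReasoning
      X∷ʳa↭ : X ∷ʳ a ↭ map (m +_) (downToOne N)
      X∷ʳa↭ = ↭-trans (↭-reflexive (sym (map-++ (m +_) (L N) (⌈ N /2⌉ ∷ [])))) (↭.map⁺ (m +_) (L-↭ (M + r)))
      cs∷ʳb↭ : cs ∷ʳ b ↭ map suc (downToOne M)
      cs∷ʳb↭ = ↭-trans (↭-reflexive (sym (map-++ suc (L M) (⌈ M /2⌉ ∷ [])))) (↭.map⁺ suc (L-↭ M′))

  σ-cyclic : IsCyclic n σ
  σ-cyclic = σ-↭-oneTo , λ j j∈ → ∈-orbit σ 1 n (↭.∈-resp-↭ (↭-sym (↭-trans orbit-σ target-↭-oneTo)) j∈)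

  -- Inserting a, cs and 1 produces the column S over a; S stays the first column from then on.
  S : List ℕ
  S = 1 ∷ reverse cs

  U₀ : Tableau
  U₀ = (a ∷ []) ∷ []

  length-S : length S ≡ M
  length-S = cong suc (trans (length-reverse cs) length-cs)

  S≤m : All (_≤ m) S
  S≤m = s≤s z≤n ∷ All-reverse (All.map proj₂ cs-bounded)

  S≪X : S ≪ X
  S≪X = All.map (λ m<x → All.map (λ s≤m → ≤-<-trans s≤m m<x) S≤m) X-above

  a∷cs∷ʳ1-decreasing : Decreasing (a ∷ cs ∷ʳ 1)
  a∷cs∷ʳ1-decreasing =
    Allₚ.++⁺ (All.map (λ (_ , c≤m) → ≤-<-trans c≤m m<a) cs-bounded) (<-trans (s≤s (s≤s z≤n)) m<a ∷ [])
    ∷ AllPairsₚ.++⁺ cs-decreasing ([] ∷ []) (All.map (λ (1<c , _) → 1<c ∷ []) cs-bounded)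
    where
      m<a : m < a
      m<a = m<m+n m z<s

  P-σ-after-X : P σ ≡ insertT b (twoColumns S (reverse (drop r X)) ++ insertAll U₀ (take r X))
  P-σ-after-X = begin
    insertAll U₀ ρ
      ≡⟨ cong (insertAll U₀) (sym (∷ʳ-++ cs 1 (X ++ b ∷ []))) ⟩
    insertAll U₀ (cs ∷ʳ 1 ++ X ++ b ∷ [])
      ≡⟨ insertAll-++ U₀ (cs ∷ʳ 1) (X ++ b ∷ []) ⟩
    insertAll (insertAll (column (a ∷ [])) (cs ∷ʳ 1)) (X ++ b ∷ [])
      ≡⟨ cong (λ T → insertAll T (X ++ b ∷ [])) column-phase ⟩
    insertAll (twoColumns S [] ++ U₀) (X ++ b ∷ [])
      ≡⟨ insertAll-++ (twoColumns S [] ++ U₀) X (b ∷ []) ⟩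
    insertT b (insertAll (twoColumns S [] ++ U₀) X)
      ≡⟨ cong (insertT b) (insertAll-twoColumns X [] U₀ r z≤n total X-decreasing S≪X) ⟩
    insertT b (twoColumns S (reverse (drop r X)) ++ insertAll U₀ (take r X)) ∎
    where
      open ≡-Reasoning
      total : length X ≡ suc (length (reverse cs)) + r
      total = trans length-X (cong (λ k → suc k + r) (sym (trans (length-reverse cs) length-cs)))
      column-phase : insertAll (column (a ∷ [])) (cs ∷ʳ 1) ≡ twoColumns S [] ++ U₀
      column-phase = begin
        insertAll (column (a ∷ [])) (cs ∷ʳ 1) ≡⟨ insertAll-column (cs ∷ʳ 1) (a ∷ []) ↑ ⟩
        column (reverse (cs ∷ʳ 1) ++ a ∷ [])  ≡⟨ cong (λ xs → column (xs ++ a ∷ [])) (reverse-++ cs (1 ∷ [])) ⟩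
        column (S ++ a ∷ [])                  ≡⟨ map-++ (_∷ []) S (a ∷ []) ⟩
        column S ++ U₀                        ≡⟨ cong (_++ U₀) (sym (twoColumns-[] S)) ⟩
        twoColumns S [] ++ U₀                 ∎
        where
          ↑ : Increasing (reverse (cs ∷ʳ 1) ++ a ∷ [])
          ↑ = subst Increasing (unfold-reverse a (cs ∷ʳ 1)) (AllPairs-reverse a∷cs∷ʳ1-decreasing)

  Γ-P-a∷X-prefix : Γ (P (a ∷ take (suc r) X)) ≡ 2 ∷ replicate r 1
  Γ-P-a∷X-prefix with L-head (M′ + r)
  ... | tl , L≡ = begin
    Γ (P (a ∷ take (suc r) X))             ≡⟨ cong (λ ys → Γ (P (a ∷ ys))) take≡ ⟩
    Γ (P (a ∷ n ∷ take r X′))              ≡⟨ Γ-P-hook (take r X′) a<n n∷X′↓ X′≢a ⟩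
    2 ∷ replicate (length (take r X′)) 1   ≡⟨ cong (λ k → 2 ∷ replicate k 1) (trans (length-take r X′) (m≤n⇒m⊓n≡m r≤|X′|)) ⟩
    2 ∷ replicate r 1                      ∎
    where
      open ≡-Reasoning
      X′ : List ℕ
      X′ = map (m +_) tl
      take≡ : take (suc r) X ≡ n ∷ take r X′
      take≡ = cong (λ ys → take (suc r) (map (m +_) ys)) L≡
      n∷X′↓ : Decreasing (n ∷ take r X′)
      n∷X′↓ = subst Decreasing take≡ (AllPairsₚ.take⁺ (suc r) X-decreasing)
      X′≢a : All (_≢ a) (take r X′)
      X′≢a = All.tail (subst (All (_≢ a)) take≡ (Allₚ.take⁺ (suc r) X-avoids-a))
      r≤|X′| : r ≤ length X′
      r≤|X′| = subst (r ≤_) (suc-injective (trans (sym length-X) (cong (length ∘ map (m +_)) L≡))) (m≤n+m r M′)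

  length-drop-r-X : length (drop r X) ≡ M
  length-drop-r-X = trans (length-drop r X) (trans (cong (_∸ r) length-X) (m+n∸n≡m M r))

  length-reverse-drop-r-X : ∀ {q Q′} → drop r X ≡ q ∷ Q′ → length (reverse Q′) ≡ length (reverse cs)
  length-reverse-drop-r-X {q} {Q′} drop≡ = begin
    length (reverse Q′) ≡⟨ length-reverse Q′ ⟩
    length Q′           ≡⟨ suc-injective (trans (cong length (sym drop≡)) length-drop-r-X) ⟩
    M′                  ≡⟨ sym (trans (length-reverse cs) length-cs) ⟩
    length (reverse cs) ∎
    where open ≡-Reasoning

  insertT-b : ∀ {q Q′} U → drop r X ≡ q ∷ Q′ →
              insertT b (twoColumns S (reverse (drop r X)) ++ U) ≡ twoColumns S (b ∷ reverse Q′) ++ insertT q U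
  insertT-b {q} {Q′} U drop≡ =
    trans (cong (λ E → insertT b (twoColumns S E ++ U)) reverse-drop≡)
          (insertT-twoColumns-push (reverse cs) (reverse Q′) U (length-reverse-drop-r-X drop≡) 1<b b∷Q↑ cs≪Q)
    where
      1<b : 1 < b
      1<b = s≤s (s≤s z≤n)
      reverse-drop≡ : reverse (drop r X) ≡ reverse Q′ ∷ʳ q
      reverse-drop≡ = trans (cong reverse drop≡) (unfold-reverse q Q′)
      q∷Q′∷ʳb↓ : Decreasing (q ∷ Q′ ∷ʳ b)
      q∷Q′∷ʳb↓ = AllPairsₚ.++⁺ (subst Decreasing drop≡ (AllPairsₚ.drop⁺ r X-decreasing)) ([] ∷ [])
                   (All.map (_∷ []) (subst (All (b <_)) drop≡ (Allₚ.drop⁺ r (All.map (≤-<-trans b≤m) X-above))))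
      b∷Q↑ : Increasing (b ∷ reverse Q′ ∷ʳ q)
      b∷Q↑ = subst Increasing (trans (reverse-++ (q ∷ Q′) (b ∷ [])) (cong (b ∷_) (unfold-reverse q Q′)))
                   (AllPairs-reverse q∷Q′∷ʳb↓)
      cs≪Q : reverse cs ≪ reverse Q′ ∷ʳ q
      cs≪Q = subst (reverse cs ≪_) reverse-drop≡ (All-reverse (≪-tailˡ (Allₚ.drop⁺ r S≪X)))

  Γ-P-σ : Γ (P σ) ≡ replicate m 2 ++ replicate r 1
  Γ-P-σ with drop r X in drop≡
  ... | []     = contradiction (trans (sym (cong length drop≡)) length-drop-r-X) (λ ())
  ... | q ∷ Q′ = begin
    Γ (P σ)                                                 ≡⟨ cong Γ P-σ-after-X ⟩
    Γ (insertT b (twoColumns S (reverse (drop r X)) ++ U₁)) ≡⟨ cong Γ (insertT-b U₁ drop≡) ⟩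
    Γ (twoColumns S (b ∷ reverse Q′) ++ insertT q U₁)       ≡⟨ map-++ length (twoColumns S (b ∷ reverse Q′)) (insertT q U₁) ⟩
    Γ (twoColumns S (b ∷ reverse Q′)) ++ Γ (insertT q U₁)   ≡⟨ cong₂ _++_ Γ-rows (cong Γ U₁∷q) ⟩
    replicate M 2 ++ Γ (P (a ∷ take (suc r) X))             ≡⟨ cong (replicate M 2 ++_) Γ-P-a∷X-prefix ⟩
    replicate M 2 ++ 2 ∷ replicate r 1                      ≡⟨ replicate-∷-++ M 2 (replicate r 1) ⟩
    replicate m 2 ++ replicate r 1                          ∎
    where
      open ≡-Reasoning
      U₁ : Tableau
      U₁ = insertAll U₀ (take r X)
      Γ-rows : Γ (twoColumns S (b ∷ reverse Q′)) ≡ replicate M 2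
      Γ-rows = trans (Γ-twoColumns S (b ∷ reverse Q′) (cong suc (length-reverse-drop-r-X drop≡)))
                     (cong (λ k → replicate k 2) length-S)
      U₁∷q : insertT q U₁ ≡ P (a ∷ take (suc r) X)
      U₁∷q = trans (sym (insertAll-++ U₀ (take r X) (q ∷ []))) (cong (insertAll U₀) (sym (take-suc-drop r X drop≡)))

  theorem : IsCyclic n (B' m n) × Γ (P (B' m n)) ≡ replicate m 2 ++ replicate r 1
  theorem = subst (λ τ → IsCyclic n τ × Γ (P τ) ≡ replicate m 2 ++ replicate r 1) (sym B'≡σ) (σ-cyclic , Γ-P-σ)

lemma3p10 : ∀ (m n : ℕ) → 1 < m → 2 * m ≤ n →
    IsCyclic n (B' m n) × Γ (P (B' m n)) ≡ replicate m 2 ++ replicate (n ∸ 2 * m) 1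
lemma3p10 m@(suc (suc M′)) n (s≤s (s≤s z≤n)) 2m≤n with m≤n⇒∃[o]m+o≡n 2m≤n
... | r , 2m+r≡n = subst Goal (trans (sym 2m+r≡n′) 2m+r≡n)
                     (proj₁ C.theorem , trans (proj₂ C.theorem) (cong (λ k → replicate m 2 ++ replicate k 1) r≡))
  where
    module C = Construction M′ r
    Goal : ℕ → Set
    Goal k = IsCyclic k (B' m k) × Γ (P (B' m k)) ≡ replicate m 2 ++ replicate (k ∸ 2 * m) 1
    2m+r≡n′ : 2 * m + r ≡ C.n
    2m+r≡n′ = trans (+-assoc m (m + 0) r) (cong (λ k → m + (k + r)) (+-identityʳ m))
    r≡ : r ≡ C.n ∸ 2 * m
    r≡ = trans (sym (m+n∸m≡n (2 * m) r)) (cong (_∸ 2 * m) 2m+r≡n′)
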